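{- For any integer $k\ge1$, \[ \sum_{n=k+1}^\infty\frac{n(n+1)(n-k-1)!}{(n+k+1)!}=\frac{2k^3+5k^2+3k+1}{(2k-1)(2k+1)(2k+1)!}. \] -}

module Defs where

open import Data.Nat as ℕ using (ℕ; zero; suc; _+_; _*_; _∸_; _!; _≥_; NonZero; z≤n; s≤s; >-nonZero)
open import Data.Nat.Properties using (_!≢0; m*n≢0; m≤n+m; ≤-trans)
open import Data.Integer using (+_)
open import Data.Rational using (ℚ; _/_; 0ℚ; _<_; ∣_∣) renaming (_+_ to _+ℚ_; _-_ to _-ℚ_)
open import Data.Product using (∃; Σ)

-- The n-th summand  n(n+1)(n-k-1)! / (n+k+1)!   (for n ≥ k+1, ∸ is exact subtraction)
term : ℕ → ℕ → ℚ
term k n = (+ (n * (n + 1) * ((n ∸ k ∸ 1) !))) / ((n + k + 1) !)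
  where instance _ = (n + k + 1) !≢0

partialSum : ℕ → ℕ → ℚ
partialSum k zero    = 0ℚ
partialSum k (suc M) = partialSum k M +ℚ term k (k + 1 + M)

rhsDen : ℕ → ℕ
rhsDen k = (2 * k ∸ 1) * (2 * k + 1) * ((2 * k + 1) !)

rhsDen-nonZero : ∀ k → .{{NonZero k}} → NonZero (rhsDen k)
rhsDen-nonZero (suc j) =
  m*n≢0 ((2 * suc j ∸ 1) * (2 * suc j + 1)) ((2 * suc j + 1) !)
    {{m*n≢0 (2 * suc j ∸ 1) (2 * suc j + 1)
       {{>-nonZero (≤-trans (s≤s z≤n) (m≤n+m (suc (j + 0)) j))}}
       {{>-nonZero (≤-trans (s≤s z≤n) (m≤n+m 1 (2 * suc j)))}}}}
    {{(2 * suc j + 1) !≢0}}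

rhs : (k : ℕ) → .{{NonZero k}} → ℚ
rhs k = (+ (2 * k * k * k + 5 * k * k + 3 * k + 1)) / rhsDen k
  where instance _ = rhsDen-nonZero k

ConvergesTo : (ℕ → ℚ) → ℚ → Set
ConvergesTo s L = ∀ (ε : ℚ) → 0ℚ < ε → ∃ λ N → ∀ M → M ≥ N → ∣ s M -ℚ L ∣ < ε

{-# OPTIONS --safe #-}
-- Let N = k + 1 + M.  The tail of the series from n = N on is
--   R_M = P(M) M! / ((2k-1)(2k+1)(2k+1+M)!),  P(M) = 2k³+5k²+3k+1 + (2k+1) M (M+2k+2),
-- because R_M - R_{M+1} is the summand at n = N, which after clearing denominators is the
-- polynomial identity P(M)(2k+2+M) = (2k-1)(2k+1) N(N+1) + P(M+1)(M+1).  As R_0 is the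
-- right-hand side, the M-th partial sum differs from it by R_M, and P(M) ≤ (2k+1)N² with
-- N ≤ 2k+M gives 0 ≤ R_M ≤ 1/(M+1).
module Submission where

import Algebra.Properties.AbelianGroup as AbelianGroupProperties
open import Data.Nat as ℕ using (ℕ; zero; suc; NonZero; _+_; _*_; _∸_; _!; s≤s)
open import Data.Nat.Combinatorics using (k![n∸k]!∣n!)
open import Data.Nat.Divisibility using (∣⇒≤; ∣-trans; m∣m*n)
import Data.Nat.Properties as ℕ
open import Data.Nat.Tactic.RingSolver using (solve-∀)
open import Data.Integer as ℤ using (+_; +≤+; +<+)
open import Data.Integer.Properties using (pos-*; pos-+)
open import Data.Rational as ℚ using (ℚ; mkℚ; _/_; *<*; toℚᵘ)
import Data.Rational.Properties as ℚ
open import Data.Rational.Unnormalised as ℚᵘ using (mkℚᵘ; _≃_; *≡*)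
import Data.Rational.Unnormalised.Properties as ℚᵘ
open import Data.Product using (_,_)
open import Relation.Binary.PropositionalEquality
open import Defs

open AbelianGroupProperties ℚ.+-0-abelianGroup using (⁻¹-anti-homo‿-; xyx⁻¹≈y)

frac : ℕ → (d : ℕ) → .{{NonZero d}} → ℚ
frac p d = + p / d

private
  toℚᵘ-frac : ∀ p d .{{_ : NonZero d}} → toℚᵘ (frac p d) ≃ (+ p) ℚᵘ./ d
  toℚᵘ-frac p (suc d) = ℚ.toℚᵘ-fromℚᵘ (mkℚᵘ (+ p) d)

  pos-cross : ∀ {p q d e} → p * e ≡ q * d → + p ℤ.* + e ≡ + q ℤ.* + d
  pos-cross {p} {q} {d} {e} eq = trans (sym (pos-* p e)) (trans (cong +_ eq) (pos-* q d))

frac-cross : ∀ p q d e .{{_ : NonZero d}} .{{_ : NonZero e}} →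
             p * e ≡ q * d → frac p d ≡ frac q e
frac-cross p q (suc d) (suc e) eq =
  ℚ.fromℚᵘ-cong {mkℚᵘ (+ p) d} {mkℚᵘ (+ q) e} (*≡* (pos-cross {p} {q} {suc d} {suc e} eq))

frac-mono-≤ : ∀ p q d e .{{_ : NonZero d}} .{{_ : NonZero e}} →
              p * e ℕ.≤ q * d → frac p d ℚ.≤ frac q e
frac-mono-≤ p q d@(suc _) e@(suc _) le = ℚ.toℚᵘ-cancel-≤ (begin
  toℚᵘ (frac p d)  ≃⟨ toℚᵘ-frac p d ⟩
  (+ p) ℚᵘ./ d     ≤⟨ ℚᵘ.*≤* (subst₂ ℤ._≤_ (pos-* p e) (pos-* q d) (+≤+ le)) ⟩
  (+ q) ℚᵘ./ e     ≃⟨ toℚᵘ-frac q e ⟨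
  toℚᵘ (frac q e)  ∎)
  where open ℚᵘ.≤-Reasoning

frac-mono-< : ∀ p q d e .{{_ : NonZero d}} .{{_ : NonZero e}} →
              p * e ℕ.< q * d → frac p d ℚ.< frac q e
frac-mono-< p q d@(suc _) e@(suc _) lt = ℚ.toℚᵘ-cancel-< (begin-strict
  toℚᵘ (frac p d)  ≃⟨ toℚᵘ-frac p d ⟩
  (+ p) ℚᵘ./ d     <⟨ ℚᵘ.*<* (subst₂ ℤ._<_ (pos-* p e) (pos-* q d) (+<+ lt)) ⟩
  (+ q) ℚᵘ./ e     ≃⟨ toℚᵘ-frac q e ⟨
  toℚᵘ (frac q e)  ∎)
  where open ℚᵘ.≤-Reasoning

frac-+ : ∀ p q d e .{{_ : NonZero d}} .{{_ : NonZero e}} →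
         frac p d ℚ.+ frac q e ≡ frac (p * e + q * d) (d * e) {{ℕ.m*n≢0 d e}}
frac-+ p q d@(suc _) e@(suc _) = ℚ.toℚᵘ-injective (begin-equality
  toℚᵘ (frac p d ℚ.+ frac q e)
    ≃⟨ ℚ.toℚᵘ-homo-+ (frac p d) (frac q e) ⟩
  toℚᵘ (frac p d) ℚᵘ.+ toℚᵘ (frac q e)
    ≃⟨ ℚᵘ.+-cong (toℚᵘ-frac p d) (toℚᵘ-frac q e) ⟩
  ((+ p) ℤ.* (+ e) ℤ.+ (+ q) ℤ.* (+ d)) ℚᵘ./ (d * e)
    ≡⟨ cong (ℚᵘ._/ (d * e)) numerator ⟩
  (+ (p * e + q * d)) ℚᵘ./ (d * e)
    ≃⟨ toℚᵘ-frac (p * e + q * d) (d * e) ⟨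
  toℚᵘ (frac (p * e + q * d) (d * e)) ∎)
  where
  open ℚᵘ.≤-Reasoning
  numerator : (+ p) ℤ.* (+ e) ℤ.+ (+ q) ℤ.* (+ d) ≡ + (p * e + q * d)
  numerator = trans (sym (cong₂ ℤ._+_ (pos-* p e) (pos-* q d))) (sym (pos-+ (p * e) (q * d)))

frac-+-same : ∀ p q d .{{_ : NonZero d}} → frac p d ℚ.+ frac q d ≡ frac (p + q) d
frac-+-same p q d = trans (frac-+ p q d d)
  (frac-cross (p * d + q * d) (p + q) (d * d) d {{ℕ.m*n≢0 d d}} (identity p q d))
  where
  identity : ∀ p q d → (p * d + q * d) * d ≡ (p + q) * (d * d)
  identity = solve-∀

frac-*-cancelˡ : ∀ c p d .{{_ : NonZero (c * d)}} .{{_ : NonZero d}} →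
                 frac (c * p) (c * d) ≡ frac p d
frac-*-cancelˡ c p d = frac-cross (c * p) p (c * d) d (identity c p d)
  where
  identity : ∀ c p d → c * p * d ≡ p * (c * d)
  identity = solve-∀

∣p-[p+q]∣≡q : ∀ p {q} → ℚ.0ℚ ℚ.≤ q → ℚ.∣ p ℚ.- (p ℚ.+ q) ∣ ≡ q
∣p-[p+q]∣≡q p {q} 0≤q = begin
  ℚ.∣ p ℚ.- (p ℚ.+ q) ∣        ≡⟨ ℚ.∣-p∣≡∣p∣ (p ℚ.- (p ℚ.+ q)) ⟨
  ℚ.∣ ℚ.- (p ℚ.- (p ℚ.+ q)) ∣  ≡⟨ cong ℚ.∣_∣ (⁻¹-anti-homo‿- p (p ℚ.+ q)) ⟩
  ℚ.∣ p ℚ.+ q ℚ.- p ∣          ≡⟨ cong ℚ.∣_∣ (xyx⁻¹≈y p q) ⟩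
  ℚ.∣ q ∣                      ≡⟨ ℚ.0≤p⇒∣p∣≡p 0≤q ⟩
  q                            ∎
  where open ≡-Reasoning

∣s-L∣≤1/[1+M]⇒ConvergesTo : ∀ {s L} → (∀ M → ℚ.∣ s M ℚ.- L ∣ ℚ.≤ frac 1 (suc M)) →
                             ConvergesTo s L
∣s-L∣≤1/[1+M]⇒ConvergesTo bound (mkℚ (+ zero)    _ _) (*<* (+<+ ()))
∣s-L∣≤1/[1+M]⇒ConvergesTo bound (mkℚ ℤ.-[1+ _ ] _ _) (*<* ())
∣s-L∣≤1/[1+M]⇒ConvergesTo {s} {L} bound ε@(mkℚ (+ suc n) d _) _ =
  suc d , λ M M≥1+d → begin-strict
  ℚ.∣ s M ℚ.- L ∣       ≤⟨ bound M ⟩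
  frac 1 (suc M)        <⟨ frac-mono-< 1 (suc n) (suc M) (suc d) (1+d<[1+n][1+M] M≥1+d) ⟩
  frac (suc n) (suc d)  ≡⟨ ℚ.↥p/↧p≡p ε ⟩
  ε                     ∎
  where
  open ℚ.≤-Reasoning
  1+d<[1+n][1+M] : ∀ {M} → suc d ℕ.≤ M → 1 * suc d ℕ.< suc n * suc M
  1+d<[1+n][1+M] {M} M≥1+d = subst (ℕ._< suc n * suc M) (sym (ℕ.*-identityˡ (suc d)))
    (ℕ.<-≤-trans (s≤s M≥1+d) (ℕ.m≤n*m (suc M) (suc n)))

!-mono-≤ : ∀ {m n} → m ℕ.≤ n → m ! ℕ.≤ n !
!-mono-≤ {m} {n} m≤n = ∣⇒≤ {{n ℕ.!≢0}} (∣-trans (m∣m*n ((n ∸ m) !)) (k![n∸k]!∣n! m≤n))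

-- P(M) is written as M·(…) + P(0) and the factorial index as M + (2k+1), so that the index for
-- suc M is suc of the one for M, and tail k 0 is rhs k up to 0! = 1.
tailPoly : ℕ → ℕ → ℕ
tailPoly k M = M * ((2 * k + 1) * (M + 2 * k + 2)) + (2 * k * k * k + 5 * k * k + 3 * k + 1)

tailDen : ℕ → ℕ → ℕ
tailDen k M = (2 * k ∸ 1) * (2 * k + 1) * (M + (2 * k + 1)) !

tailDen-nonZero : ∀ k M .{{_ : NonZero k}} → NonZero (tailDen k M)
tailDen-nonZero k M = ℕ.m*n≢0 ((2 * k ∸ 1) * (2 * k + 1)) ((M + (2 * k + 1)) !)
  {{ℕ.m*n≢0⇒m≢0 ((2 * k ∸ 1) * (2 * k + 1)) {{rhsDen-nonZero k}}}}
  {{(M + (2 * k + 1)) ℕ.!≢0}}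

tail : (k : ℕ) → .{{NonZero k}} → ℕ → ℚ
tail k M = frac (tailPoly k M * M !) (tailDen k M) {{tailDen-nonZero k M}}

2[1+j]∸1≡1+2j : ∀ j → 2 * suc j ∸ 1 ≡ suc (2 * j)
2[1+j]∸1≡1+2j j = ℕ.+-suc j (j + 0)

tailPoly-recurrence : ∀ k M .{{_ : NonZero k}} →
  tailPoly k M * suc (M + (2 * k + 1)) ≡
  (2 * k ∸ 1) * (2 * k + 1) * ((k + 1 + M) * (k + 1 + M + 1)) + tailPoly k (suc M) * suc M
tailPoly-recurrence (suc j) M = trans (identity j M)
  (cong (λ a → a * (2 * suc j + 1) * ((suc j + 1 + M) * (suc j + 1 + M + 1))
               + tailPoly (suc j) (suc M) * suc M)
        (sym (2[1+j]∸1≡1+2j j)))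
  where
  identity : ∀ j M →
    (M * ((2 * suc j + 1) * (M + 2 * suc j + 2))
       + (2 * suc j * suc j * suc j + 5 * suc j * suc j + 3 * suc j + 1))
      * suc (M + (2 * suc j + 1))
    ≡ suc (2 * j) * (2 * suc j + 1) * ((suc j + 1 + M) * (suc j + 1 + M + 1))
      + (suc M * ((2 * suc j + 1) * (suc M + 2 * suc j + 2))
           + (2 * suc j * suc j * suc j + 5 * suc j * suc j + 3 * suc j + 1))
        * suc M
  identity = solve-∀

term-as-frac : ∀ k M → term k (k + 1 + M) ≡
  frac ((k + 1 + M) * (k + 1 + M + 1) * M !) (suc (M + (2 * k + 1)) !)
       {{suc (M + (2 * k + 1)) ℕ.!≢0}}
term-as-frac k M =
  ℚ./-cong (cong (λ m → + ((k + 1 + M) * (k + 1 + M + 1) * m !)) [k+1+M]∸k∸1≡M)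
           (cong _! (index k M))
  where
  [k+1+M]∸k∸1≡M : k + 1 + M ∸ k ∸ 1 ≡ M
  [k+1+M]∸k∸1≡M =
    cong (_∸ 1) (trans (cong (_∸ k) (ℕ.+-assoc k 1 M)) (ℕ.m+n∸m≡n k (1 + M)))
  index : ∀ k M → k + 1 + M + k + 1 ≡ suc (M + (2 * k + 1))
  index = solve-∀
  instance
    _ = (k + 1 + M + k + 1) ℕ.!≢0
    _ = suc (M + (2 * k + 1)) ℕ.!≢0

tail-step : ∀ k M .{{_ : NonZero k}} → term k (k + 1 + M) ℚ.+ tail k (suc M) ≡ tail k M
tail-step k M = begin
  term k N ℚ.+ tail k (suc M)
    ≡⟨ cong (ℚ._+ tail k (suc M)) (term-as-frac k M) ⟩
  frac (N * (N + 1) * M !) (suc D !) ℚ.+ tail k (suc M)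
    ≡⟨ cong (ℚ._+ tail k (suc M)) (frac-*-cancelˡ ab (N * (N + 1) * M !) (suc D !)) ⟨
  frac (ab * (N * (N + 1) * M !)) (ab * suc D !) ℚ.+ tail k (suc M)
    ≡⟨ frac-+-same (ab * (N * (N + 1) * M !)) (tailPoly k (suc M) * suc M !) (ab * suc D !) ⟩
  frac (ab * (N * (N + 1) * M !) + tailPoly k (suc M) * suc M !) (ab * suc D !)
    ≡⟨ cong (λ p → frac p (ab * suc D !)) (factor-M! ab (N * (N + 1)) (tailPoly k (suc M)) M) ⟩
  frac ((ab * (N * (N + 1)) + tailPoly k (suc M) * suc M) * M !) (ab * suc D !)
    ≡⟨ cong (λ p → frac (p * M !) (ab * suc D !)) (tailPoly-recurrence k M) ⟨
  frac (tailPoly k M * suc D * M !) (ab * suc D !)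
    ≡⟨ frac-cross (tailPoly k M * suc D * M !) (tailPoly k M * M !) (ab * suc D !) (ab * D !)
                  (cancel-suc-D (tailPoly k M) (M !) ab D (D !)) ⟩
  tail k M ∎
  where
  open ≡-Reasoning
  ab = (2 * k ∸ 1) * (2 * k + 1)
  D  = M + (2 * k + 1)
  N  = k + 1 + M
  instance
    _ = tailDen-nonZero k M
    _ = tailDen-nonZero k (suc M)
    _ = suc D ℕ.!≢0
  factor-M! : ∀ a y x m → a * (y * m !) + x * suc m ! ≡ (a * y + x * suc m) * m !
  factor-M! a y x m = identity a y x m (m !)
    where
    identity : ∀ a y x m r → a * (y * r) + x * (suc m * r) ≡ (a * y + x * suc m) * r
    identity = solve-∀
  cancel-suc-D : ∀ p r a d q → p * suc d * r * (a * q) ≡ p * r * (a * (suc d * q))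
  cancel-suc-D = solve-∀

tail-zero : ∀ k .{{_ : NonZero k}} → tail k 0 ≡ rhs k
tail-zero k = ℚ./-cong (cong +_ (ℕ.*-identityʳ (tailPoly k 0))) refl
  where instance _ = rhsDen-nonZero k

partialSum+tail≡rhs : ∀ k .{{_ : NonZero k}} M → partialSum k M ℚ.+ tail k M ≡ rhs k
partialSum+tail≡rhs k zero    = trans (ℚ.+-identityˡ (tail k 0)) (tail-zero k)
partialSum+tail≡rhs k (suc M) = begin
  partialSum k M ℚ.+ term k (k + 1 + M) ℚ.+ tail k (suc M)
    ≡⟨ ℚ.+-assoc (partialSum k M) _ _ ⟩
  partialSum k M ℚ.+ (term k (k + 1 + M) ℚ.+ tail k (suc M))
    ≡⟨ cong (partialSum k M ℚ.+_) (tail-step k M) ⟩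
  partialSum k M ℚ.+ tail k M
    ≡⟨ partialSum+tail≡rhs k M ⟩
  rhs k ∎
  where open ≡-Reasoning

tailPoly≤[2k+1]N² : ∀ k M → tailPoly k M ℕ.≤ (2 * k + 1) * ((k + 1 + M) * (k + 1 + M))
tailPoly≤[2k+1]N² k M = subst (tailPoly k M ℕ.≤_) (identity k M) (ℕ.m≤m+n (tailPoly k M) k)
  where
  identity : ∀ k M →
    M * ((2 * k + 1) * (M + 2 * k + 2)) + (2 * k * k * k + 5 * k * k + 3 * k + 1) + k ≡
    (2 * k + 1) * ((k + 1 + M) * (k + 1 + M))
  identity = solve-∀

b*N²*M!*[1+M]≤a*b*[2+E]! : ∀ {a E} b N M → 1 ℕ.≤ a → N ℕ.≤ suc E → suc M ℕ.≤ E →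
                           b * (N * N) * M ! * suc M ℕ.≤ a * b * suc (suc E) !
b*N²*M!*[1+M]≤a*b*[2+E]! {a} {E} b N M 1≤a N≤1+E 1+M≤E = begin
  b * (N * N) * M ! * suc M      ≡⟨ identity b N (M !) M ⟩
  1 * b * (N * (N * suc M !))    ≤⟨ ℕ.*-mono-≤ (ℕ.*-monoˡ-≤ b 1≤a)
                                      (ℕ.*-mono-≤ (ℕ.m≤n⇒m≤1+n N≤1+E)
                                        (ℕ.*-mono-≤ N≤1+E (!-mono-≤ 1+M≤E))) ⟩
  a * b * suc (suc E) !          ∎
  where
  open ℕ.≤-Reasoning
  identity : ∀ b n r m → b * (n * n) * r * suc m ≡ 1 * b * (n * (n * (suc m * r)))
  identity = solve-∀

tailPoly*M!*[1+M]≤tailDen : ∀ k M .{{_ : NonZero k}} →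
                            tailPoly k M * M ! * suc M ℕ.≤ tailDen k M
tailPoly*M!*[1+M]≤tailDen k@(suc j) M = begin
  tailPoly k M * M ! * suc M
    ≤⟨ ℕ.*-monoˡ-≤ (suc M) (ℕ.*-monoˡ-≤ (M !) (tailPoly≤[2k+1]N² k M)) ⟩
  (2 * k + 1) * (N * N) * M ! * suc M
    ≤⟨ b*N²*M!*[1+M]≤a*b*[2+E]! (2 * k + 1) N M 1≤a N≤1+E 1+M≤E ⟩
  a * (2 * k + 1) * suc (suc E) !
    ≡⟨ cong (λ n → a * (2 * k + 1) * n !) 2+E≡D ⟩
  tailDen k M ∎
  where
  open ℕ.≤-Reasoning
  a = 2 * k ∸ 1
  E = M + a
  N = k + 1 + M
  a≡1+2j : a ≡ suc (2 * j)
  a≡1+2j = 2[1+j]∸1≡1+2j j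
  1≤a : 1 ℕ.≤ a
  1≤a = subst (1 ℕ.≤_) (sym a≡1+2j) (s≤s ℕ.z≤n)
  N≤1+E : N ℕ.≤ suc E
  N≤1+E = subst (λ x → N ℕ.≤ suc (M + x)) (sym a≡1+2j)
            (subst (N ℕ.≤_) (identity j M) (ℕ.m≤m+n N j))
    where
    identity : ∀ j M → suc j + 1 + M + j ≡ suc (M + suc (2 * j))
    identity = solve-∀
  1+M≤E : suc M ℕ.≤ E
  1+M≤E = subst (λ x → suc M ℕ.≤ M + x) (sym a≡1+2j)
            (subst (suc M ℕ.≤_) (identity j M) (ℕ.m≤m+n (suc M) (2 * j)))
    where
    identity : ∀ j M → suc M + 2 * j ≡ M + suc (2 * j)
    identity = solve-∀
  2+E≡D : suc (suc E) ≡ M + (2 * k + 1)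
  2+E≡D = trans (cong (λ x → suc (suc (M + x))) a≡1+2j) (identity j M)
    where
    identity : ∀ j M → suc (suc (M + suc (2 * j))) ≡ M + (2 * suc j + 1)
    identity = solve-∀

0≤tail : ∀ k M .{{_ : NonZero k}} → ℚ.0ℚ ℚ.≤ tail k M
0≤tail k M =
  frac-mono-≤ 0 (tailPoly k M * M !) 1 (tailDen k M) {{_}} {{tailDen-nonZero k M}} ℕ.z≤n

tail≤1/[1+M] : ∀ k M .{{_ : NonZero k}} → tail k M ℚ.≤ frac 1 (suc M)
tail≤1/[1+M] k M =
  frac-mono-≤ (tailPoly k M * M !) 1 (tailDen k M) (suc M) {{tailDen-nonZero k M}}
    (subst (tailPoly k M * M ! * suc M ℕ.≤_) (sym (ℕ.*-identityˡ (tailDen k M)))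
           (tailPoly*M!*[1+M]≤tailDen k M))

lemma6p3 : (k : ℕ) → .{{_ : NonZero k}} → ConvergesTo (partialSum k) (rhs k)
lemma6p3 k = ∣s-L∣≤1/[1+M]⇒ConvergesTo {partialSum k} {rhs k} λ M → begin
  ℚ.∣ partialSum k M ℚ.- rhs k ∣
    ≡⟨ cong (λ L → ℚ.∣ partialSum k M ℚ.- L ∣) (partialSum+tail≡rhs k M) ⟨
  ℚ.∣ partialSum k M ℚ.- (partialSum k M ℚ.+ tail k M) ∣
    ≡⟨ ∣p-[p+q]∣≡q (partialSum k M) (0≤tail k M) ⟩
  tail k M
    ≤⟨ tail≤1/[1+M] k M ⟩
  frac 1 (suc M) ∎
  where open ℚ.≤-Reasoning
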